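{- Let $n\ge 4$ and let $\mathcal{R}\subseteq 2^{[2n]}$ be a restrictive collection. Then $\mathcal{R}$ does not contain a copy of $2^{[n]}$, i.e. there is no poset embedding $f:2^{[n]}\to 2^{[2n]}$ whose image is contained in $\mathcal{R}$.
   Context: Partition $[2n]$ into the $n$ pairs $\{1,2\},\{3,4\},\dots,\{2n-1,2n\}$ (so $a,b$ are in the same pair iff $\lceil a/2\rceil=\lceil b/2\rceil$). A set $S\subseteq[2n]$ has a pair if it contains both elements of that pair, and misses the pair if it contains neither element. A collection $\mathcal{R}\subseteq 2^{[2n]}$ is restrictive if all of the following hold: (i) (pair-enforcing) every $S\in\mathcal{R}$ with $\lceil n/2\rceil\le |S|<n$ has at least one pair; (ii) (miss-forbidding) every $S\in\mathcal{R}$ with $n<|S|\le n+\lfloor n/2\rfloor$ misses no pair; (iii) (not-too-high) every $S\in\mathcal{R}$ satisfies $|S|\le n+\lfloor n/2\rfloor$; (iv) (flip-susceptible) whenever $S_1,S_2\subseteq[2n]$ satisfy $|S_1|=|S_2|=n$, $|S_1\cup S_2|=n+1$, and neither $S_1$ nor $S_2$ has any pair, at most one of $S_1,S_2$ lies in $\mathcal{R}$. A poset embedding $f:2^{[n]}\to 2^{[2n]}$ is an injective map with $S\subseteq T\iff f(S)\subseteq f(T)$; its image is a copy of $2^{[n]}$. -}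

module Defs where

open import Data.Nat using (ℕ; _+_; _*_; _≤_; _<_; ⌈_/2⌉; ⌊_/2⌋)
open import Data.Fin using (Fin; toℕ)
open import Data.Fin.Subset using (Subset; _∈_; _∉_; _⊆_; _∪_; ∣_∣)
open import Data.Product using (Σ; _×_; ∃)
open import Relation.Binary.PropositionalEquality using (_≡_; _≢_)
open import Relation.Nullary using (¬_)

-- Element k (0-based) corresponds to k+1 (1-based); the pairs
-- {1,2},{3,4},... become {0,1},{2,3},...; a, b are in the same pair
-- iff ⌈(a+1)/2⌉ = ⌈(b+1)/2⌉, i.e. ⌊a/2⌋ = ⌊b/2⌋ in 0-based terms.
SamePair : {m : ℕ} → Fin m → Fin m → Set
SamePair a b = ⌊ toℕ a /2⌋ ≡ ⌊ toℕ b /2⌋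

HasPair : {m : ℕ} → Subset m → Set
HasPair {m} S = Σ (Fin m) λ a → Σ (Fin m) λ b →
  (a ≢ b) × SamePair a b × (a ∈ S) × (b ∈ S)

MissesPair : {m : ℕ} → Subset m → Set
MissesPair {m} S = Σ (Fin m) λ a → (b : Fin m) → SamePair a b → b ∉ S

Restrictive : (n : ℕ) → (Subset (2 * n) → Set) → Set
Restrictive n R =
  ((S : Subset (2 * n)) → R S → ⌈ n /2⌉ ≤ ∣ S ∣ → ∣ S ∣ < n → HasPair S)
  × ((S : Subset (2 * n)) → R S → n < ∣ S ∣ → ∣ S ∣ ≤ n + ⌊ n /2⌋ → ¬ MissesPair S)
  × ((S : Subset (2 * n)) → R S → ∣ S ∣ ≤ n + ⌊ n /2⌋)
  × ((S₁ S₂ : Subset (2 * n)) → ∣ S₁ ∣ ≡ n → ∣ S₂ ∣ ≡ n → ∣ S₁ ∪ S₂ ∣ ≡ n + 1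
       → ¬ HasPair S₁ → ¬ HasPair S₂ → ¬ (R S₁ × R S₂))

record PosetEmbedding (n : ℕ) : Set where
  field
    fun       : Subset n → Subset (2 * n)
    injective : (S T : Subset n) → fun S ≡ fun T → S ≡ T
    monotone  : (S T : Subset n) → S ⊆ T → fun S ⊆ fun T
    reflects  : (S T : Subset n) → fun S ⊆ fun T → S ⊆ T

module Submission where

-- Since f {i} ⊈ f ([n] ∖ {i}), each i has a witness x_i with x_i ∈ f S ⟺ i ∈ S.  The witnesses form
-- a set X of n points, every image lies in X ∪ W with W = f [n] ∖ X, and not-too-high gives
-- |W| ≤ ⌊n/2⌋.  Prescribing f S ∩ X through S = {i | x_i ∈ Q} builds images with controlled pairs:
-- a transversal (one end of each pair meeting X, avoiding partners of W) has a pair-free image of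
-- size at least ⌈n/2⌉, hence of size exactly n by pair-enforcing.  In turn: W holds no pair (else a
-- weighted count beats not-too-high, or deleting a lone witness gives a pair-free image of size in
-- [⌈n/2⌉, n)); X holds no pair (else the two transversals through its two ends are pair-free of size
-- n with union of size n + 1, against flip-susceptibility); and then every point of W is forced
-- into f ([n] ∖ {i}) for some witness x_i whose pair is missed, so this image has more than n
-- points, against miss-forbidding.

open import Defs
open import Data.Nat using (ℕ; zero; suc; _+_; _*_; _≤_; _<_; z≤n; s≤s; s≤s⁻¹; ⌈_/2⌉; ⌊_/2⌋; _≤?_; _<?_)
open import Data.Nat.Properties hiding (_≟_)
open import Data.Fin using (Fin; zero; suc; toℕ; fromℕ<; _≟_)
open import Data.Fin.Properties using (toℕ-injective; toℕ-fromℕ<; toℕ<n; any?)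
open import Data.Fin.Permutation using (permutation)
open import Data.Fin.Subset using (Subset; _∈_; _∉_; _⊆_; _∪_; ∣_∣; ⁅_⁆; ∁)
open import Data.Fin.Subset.Properties using (x∈⁅x⁆; x∈⁅y⁆⇒x≡y; x∈∁p⇒x∉p; x∉p⇒x∈∁p; _∈?_)
open import Data.Vec using ([]; _∷_; lookup; tabulate)
open import Data.Vec.Properties using ([]=⇒lookup; lookup⇒[]=; lookup-zipWith; lookup∘tabulate)
open import Data.Bool using (Bool; true; false; not; _∧_; _∨_; if_then_else_)
open import Data.Bool.Properties using (¬-not; ∧-zeroʳ; ∧-identityʳ; ∨-identityʳ; ∨-comm; ∨-assoc; ∨-idem)
import Data.Bool.Properties as Bool
open import Data.Nat.Tactic.RingSolver using (solve-∀)
open import Data.Product using (Σ; _×_; _,_; proj₁; proj₂; ∃)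
open import Data.Sum using (_⊎_; inj₁; inj₂)
open import Data.Empty using (⊥; ⊥-elim)
open import Function using (_∘_)
open import Relation.Nullary using (¬_; ¬?; yes; no; does; _×-dec_)
open import Relation.Nullary.Decidable using (dec-true; dec-false)
open import Relation.Binary.PropositionalEquality
open import Algebra.Properties.Semiring.Sum +-*-semiring
  using (sum; sum-cong-≗; ∑-distrib-+; ∑-comm; sum-permute; *-distribˡ-sum)

true≢false : true ≢ false
true≢false ()

does-≟⇒≡ : ∀ {k} (a b : Fin k) → does (a ≟ b) ≡ true → a ≡ b
does-≟⇒≡ a b d with a ≟ b
... | yes a≡b = a≡b

∧-true : ∀ {u v} → (u ∧ v) ≡ true → u ≡ true × v ≡ true
∧-true {true} {true} _ = refl , refl

χ : Bool → ℕ
χ true = 1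
χ false = 0

χ≤1 : ∀ b → χ b ≤ 1
χ≤1 true = s≤s z≤n
χ≤1 false = z≤n

χ-∨-disjoint : ∀ u v → (v ≡ true → u ≡ false) → χ (u ∨ v) ≡ χ u + χ v
χ-∨-disjoint true true v⇒¬u = ⊥-elim (true≢false (v⇒¬u refl))
χ-∨-disjoint true false _ = refl
χ-∨-disjoint false v _ = refl

card : ∀ {k} → (Fin k → Bool) → ℕ
card p = sum (χ ∘ p)

δ : ∀ {k} → Fin k → Fin k → ℕ
δ b a = χ (does (a ≟ b))

sum-mono-≤ : ∀ {k} (f g : Fin k → ℕ) → (∀ a → f a ≤ g a) → sum f ≤ sum g
sum-mono-≤ {zero} f g f≤g = z≤n
sum-mono-≤ {suc k} f g f≤g = +-mono-≤ (f≤g zero) (sum-mono-≤ (f ∘ suc) (g ∘ suc) (f≤g ∘ suc))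

sum-mono-< : ∀ {k} (f g : Fin k → ℕ) → (∀ a → f a ≤ g a) → ∀ a → f a < g a → sum f < sum g
sum-mono-< {suc k} f g f≤g zero fa<ga = +-mono-<-≤ fa<ga (sum-mono-≤ (f ∘ suc) (g ∘ suc) (f≤g ∘ suc))
sum-mono-< {suc k} f g f≤g (suc a) fa<ga = +-mono-≤-< (f≤g zero) (sum-mono-< (f ∘ suc) (g ∘ suc) (f≤g ∘ suc) a fa<ga)

sum-≥⇒≗ : ∀ {k} (f g : Fin k → ℕ) → (∀ a → f a ≤ g a) → sum g ≤ sum f → ∀ a → f a ≡ g a
sum-≥⇒≗ f g f≤g Σg≤Σf a with m≤n⇒m<n∨m≡n (f≤g a)
... | inj₂ fa≡ga = fa≡ga
... | inj₁ fa<ga = ⊥-elim (<⇒≱ (sum-mono-< f g f≤g a fa<ga) Σg≤Σf)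

sum-zero : ∀ {k} (f : Fin k → ℕ) → (∀ a → f a ≡ 0) → sum f ≡ 0
sum-zero {zero} f f≡0 = refl
sum-zero {suc k} f f≡0 rewrite f≡0 zero = sum-zero (f ∘ suc) (f≡0 ∘ suc)

sum-ones : ∀ k → sum {k} (λ _ → 1) ≡ k
sum-ones zero = refl
sum-ones (suc k) = cong suc (sum-ones k)

δ-suc : ∀ {k} (b a : Fin k) → δ (suc b) (suc a) ≡ δ b a
δ-suc b a with a ≟ b
... | yes _ = refl
... | no _ = refl

sum-δ : ∀ {k} (b : Fin k) → sum (δ b) ≡ 1
sum-δ {suc k} zero = cong suc (sum-zero {k} _ λ _ → refl)
sum-δ {suc k} (suc b) = trans (sum-cong-≗ (δ-suc b)) (sum-δ b)

sum-+-δ : ∀ {k} (f : Fin k → ℕ) b → sum (λ a → f a + δ b a) ≡ sum f + 1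
sum-+-δ f b = trans (∑-distrib-+ f (δ b)) (cong (sum f +_) (sum-δ b))

sum-involution : ∀ {k} (p : Fin k → Fin k) → (∀ a → p (p a) ≡ a) → (f : Fin k → ℕ) → sum (f ∘ p) ≡ sum f
sum-involution p pp f = sym (sum-permute f (permutation p p pp pp))

card-pos : ∀ {k} (p : Fin k → Bool) → 1 ≤ card p → ∃ λ a → p a ≡ true
card-pos {suc k} p 1≤ with p zero in p0
... | true = zero , p0
... | false with card-pos (p ∘ suc) 1≤
...   | a , pa = suc a , pa

card≥1 : ∀ {k} (p : Fin k → Bool) a → p a ≡ true → 1 ≤ card p
card≥1 p a pa = ≤-trans (≤-reflexive (sym (sum-δ a))) (sum-mono-≤ (δ a) _ δa≤p)
  where
  δa≤p : ∀ c → δ a c ≤ χ (p c)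
  δa≤p c with c ≟ a
  ... | yes refl rewrite pa = ≤-refl
  ... | no _ = z≤n

card≥2 : ∀ {k} (p : Fin k → Bool) a b → p a ≡ true → p b ≡ true → a ≢ b → 2 ≤ card p
card≥2 p a b pa pb a≢b = begin
  2                              ≡⟨ cong₂ _+_ (sum-δ a) (sum-δ b) ⟨
  sum (δ a) + sum (δ b)          ≡⟨ ∑-distrib-+ (δ a) (δ b) ⟨
  sum (λ c → δ a c + δ b c)      ≤⟨ sum-mono-≤ _ _ δa+δb≤p ⟩
  card p                         ∎
  where
  open ≤-Reasoning
  δa+δb≤p : ∀ c → δ a c + δ b c ≤ χ (p c)
  δa+δb≤p c with c ≟ a | c ≟ b
  ... | yes refl | yes refl = ⊥-elim (a≢b refl)
  ... | yes refl | no _ rewrite pa = ≤-refl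
  ... | no _ | yes refl rewrite pb = ≤-refl
  ... | no _ | no _ = z≤n

card-0 : ∀ {k} (p : Fin k → Bool) → card p ≡ 0 → ∀ a → p a ≡ false
card-0 p c≡0 a = ¬-not λ pa → 1+n≰n (subst (1 ≤_) c≡0 (card≥1 p a pa))

card-remove : ∀ {k} (p : Fin k → Bool) b → p b ≡ true → card (λ a → p a ∧ not (does (a ≟ b))) + 1 ≡ card p
card-remove p b pb = trans (sym (sum-+-δ (λ a → χ (p a ∧ not (does (a ≟ b)))) b)) (sum-cong-≗ pointwise)
  where
  pointwise : ∀ a → χ (p a ∧ not (does (a ≟ b))) + δ b a ≡ χ (p a)
  pointwise a with a ≟ b
  ... | yes refl rewrite pb = refl
  ... | no _ = trans (+-identityʳ _) (cong χ (∧-identityʳ (p a)))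

∣∣≡card : ∀ {k} (S : Subset k) → ∣ S ∣ ≡ card (lookup S)
∣∣≡card [] = refl
∣∣≡card (true ∷ S) = cong suc (∣∣≡card S)
∣∣≡card (false ∷ S) = ∣∣≡card S

m+m≤n+n⇒m≤n : ∀ m n → m + m ≤ n + n → m ≤ n
m+m≤n+n⇒m≤n m n m+m≤n+n with ≤-<-connex m n
... | inj₁ m≤n = m≤n
... | inj₂ n<m = ⊥-elim (<⇒≱ (+-mono-< n<m n<m) m+m≤n+n)

m+m<n+n⇒m<n : ∀ m n → m + m < n + n → m < n
m+m<n+n⇒m<n m n m+m<n+n with ≤-<-connex n m
... | inj₂ m<n = m<n
... | inj₁ n≤m = ⊥-elim (<⇒≱ m+m<n+n (+-mono-≤ n≤m n≤m))

n≤m+m⇒⌈n/2⌉≤m : ∀ n m → n ≤ m + m → ⌈ n /2⌉ ≤ m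
n≤m+m⇒⌈n/2⌉≤m n m n≤m+m = ≤-trans (⌈n/2⌉-mono n≤m+m) (≤-reflexive (sym (n≡⌈n+n/2⌉ m)))

n+d≤z+w⇒⌈n/2⌉+d≤z : ∀ n z w d → n + d ≤ z + w → w ≤ ⌊ n /2⌋ → ⌈ n /2⌉ + d ≤ z
n+d≤z+w⇒⌈n/2⌉+d≤z n z w d n+d≤z+w w≤⌊n/2⌋ = +-cancelˡ-≤ ⌊ n /2⌋ _ _ (begin
  ⌊ n /2⌋ + (⌈ n /2⌉ + d)    ≡⟨ +-assoc ⌊ n /2⌋ ⌈ n /2⌉ d ⟨
  ⌊ n /2⌋ + ⌈ n /2⌉ + d      ≡⟨ cong (_+ d) (⌊n/2⌋+⌈n/2⌉≡n n) ⟩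
  n + d                      ≤⟨ n+d≤z+w ⟩
  z + w                      ≤⟨ +-monoʳ-≤ z w≤⌊n/2⌋ ⟩
  z + ⌊ n /2⌋                ≡⟨ +-comm z ⌊ n /2⌋ ⟩
  ⌊ n /2⌋ + z                ∎)
  where open ≤-Reasoning

partnerℕ : ℕ → ℕ
partnerℕ zero = 1
partnerℕ (suc zero) = 0
partnerℕ (suc (suc k)) = suc (suc (partnerℕ k))

partnerℕ-involutive : ∀ k → partnerℕ (partnerℕ k) ≡ k
partnerℕ-involutive zero = refl
partnerℕ-involutive (suc zero) = refl
partnerℕ-involutive (suc (suc k)) = cong (2 +_) (partnerℕ-involutive k)

partnerℕ-≢ : ∀ k → partnerℕ k ≢ k
partnerℕ-≢ (suc (suc k)) eq = partnerℕ-≢ k (suc-injective (suc-injective eq))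

⌊partnerℕ/2⌋ : ∀ k → ⌊ partnerℕ k /2⌋ ≡ ⌊ k /2⌋
⌊partnerℕ/2⌋ zero = refl
⌊partnerℕ/2⌋ (suc zero) = refl
⌊partnerℕ/2⌋ (suc (suc k)) = cong suc (⌊partnerℕ/2⌋ k)

⌊/2⌋-injective-up-to-partner : ∀ j k → ⌊ j /2⌋ ≡ ⌊ k /2⌋ → j ≡ k ⊎ j ≡ partnerℕ k
⌊/2⌋-injective-up-to-partner zero zero _ = inj₁ refl
⌊/2⌋-injective-up-to-partner zero (suc zero) _ = inj₂ refl
⌊/2⌋-injective-up-to-partner (suc zero) zero _ = inj₂ refl
⌊/2⌋-injective-up-to-partner (suc zero) (suc zero) _ = inj₁ refl
⌊/2⌋-injective-up-to-partner (suc (suc j)) (suc (suc k)) eq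
  with ⌊/2⌋-injective-up-to-partner j k (suc-injective eq)
... | inj₁ j≡k = inj₁ (cong (2 +_) j≡k)
... | inj₂ j≡k' = inj₂ (cong (2 +_) j≡k')

partnerℕ-< : ∀ k n → k < 2 * n → partnerℕ k < 2 * n
partnerℕ-< k (suc n) k<2n rewrite *-suc 2 n with k
... | zero = s≤s (s≤s z≤n)
... | suc zero = s≤s z≤n
... | suc (suc k) = s≤s (s≤s (partnerℕ-< k n (s≤s⁻¹ (s≤s⁻¹ k<2n))))

isEven : ℕ → Bool
isEven zero = true
isEven (suc zero) = false
isEven (suc (suc k)) = isEven k

isEven-partnerℕ : ∀ k → isEven (partnerℕ k) ≡ not (isEven k)
isEven-partnerℕ zero = refl
isEven-partnerℕ (suc zero) = refl
isEven-partnerℕ (suc (suc k)) = isEven-partnerℕ k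

module Pairing (n : ℕ) where

  partner : Fin (2 * n) → Fin (2 * n)
  partner a = fromℕ< (partnerℕ-< (toℕ a) n (toℕ<n a))

  toℕ-partner : ∀ a → toℕ (partner a) ≡ partnerℕ (toℕ a)
  toℕ-partner a = toℕ-fromℕ< _

  partner-involutive : ∀ a → partner (partner a) ≡ a
  partner-involutive a = toℕ-injective (begin
    toℕ (partner (partner a))     ≡⟨ toℕ-partner (partner a) ⟩
    partnerℕ (toℕ (partner a))    ≡⟨ cong partnerℕ (toℕ-partner a) ⟩
    partnerℕ (partnerℕ (toℕ a))   ≡⟨ partnerℕ-involutive (toℕ a) ⟩
    toℕ a                         ∎)
    where open ≡-Reasoning

  partner-injective : ∀ a c → partner a ≡ partner c → a ≡ c
  partner-injective a c eq = trans (sym (partner-involutive a)) (trans (cong partner eq) (partner-involutive c))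

  partner-≢ : ∀ a → a ≢ partner a
  partner-≢ a eq = partnerℕ-≢ (toℕ a) (sym (trans (cong toℕ eq) (toℕ-partner a)))

  samePair⇒≡∨partner : ∀ a b → SamePair a b → b ≡ a ⊎ b ≡ partner a
  samePair⇒≡∨partner a b eq with ⌊/2⌋-injective-up-to-partner (toℕ b) (toℕ a) (sym eq)
  ... | inj₁ b≡a = inj₁ (toℕ-injective b≡a)
  ... | inj₂ b≡a' = inj₂ (toℕ-injective (trans b≡a' (sym (toℕ-partner a))))

  even : Fin (2 * n) → Bool
  even a = isEven (toℕ a)

  even-partner : ∀ a → even (partner a) ≡ not (even a)
  even-partner a = trans (cong isEven (toℕ-partner a)) (isEven-partnerℕ (toℕ a))

  ≟-partner : ∀ a c → does (partner a ≟ c) ≡ does (a ≟ partner c)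
  ≟-partner a c with partner a ≟ c | a ≟ partner c
  ... | yes _ | yes _ = refl
  ... | no _ | no _ = refl
  ... | yes p | no ¬q = ⊥-elim (¬q (trans (sym (partner-involutive a)) (cong partner p)))
  ... | no ¬p | yes q = ⊥-elim (¬p (trans (cong partner q) (partner-involutive c)))

  ≟-partner-partner : ∀ a c → does (partner a ≟ partner c) ≡ does (a ≟ c)
  ≟-partner-partner a c with partner a ≟ partner c | a ≟ c
  ... | yes _ | yes _ = refl
  ... | no _ | no _ = refl
  ... | yes p | no ¬q = ⊥-elim (¬q (partner-injective a c p))
  ... | no ¬p | yes q = ⊥-elim (¬p (cong partner q))

  ¬HasPair : (S : Subset (2 * n)) → (∀ a → lookup S a ≡ true → lookup S (partner a) ≡ false) → ¬ HasPair S
  ¬HasPair S pf (a , b , a≢b , a~b , a∈S , b∈S) with samePair⇒≡∨partner a b a~b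
  ... | inj₁ b≡a = a≢b (sym b≡a)
  ... | inj₂ refl with trans (sym (pf a ([]=⇒lookup a∈S))) ([]=⇒lookup b∈S)
  ... | ()

  missesPair : (S : Subset (2 * n)) → ∀ a → lookup S a ≡ false → lookup S (partner a) ≡ false → MissesPair S
  missesPair S a a∉S a'∉S = a , λ b a~b b∈S → absent b (samePair⇒≡∨partner a b a~b) ([]=⇒lookup b∈S)
    where
    absent : ∀ b → b ≡ a ⊎ b ≡ partner a → lookup S b ≡ true → ⊥
    absent b (inj₁ refl) b∈S with trans (sym a∉S) b∈S
    ... | ()
    absent b (inj₂ refl) b∈S with trans (sym a'∉S) b∈S
    ... | ()

  sum-ones-pairs : sum {2 * n} (λ _ → 1) ≡ n + n
  sum-ones-pairs = trans (sum-ones (2 * n)) (cong (n +_) (+-identityʳ n))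

  sum-pairs : (f : Fin (2 * n) → ℕ) → sum (λ a → f a + f (partner a)) ≡ sum f + sum f
  sum-pairs f = trans (∑-distrib-+ f (f ∘ partner)) (cong (sum f +_) (sum-involution partner partner-involutive f))

-- The contribution of a pair {a, a′} to card Z + card W in module Choice, where x = X a, w = W a,
-- s = side a, and the primed arguments are those of a′.
pairWeight : Bool → Bool → Bool → Bool → Bool → ℕ
pairWeight x x′ w w′ s =
  χ (x ∧ (if x′ then s else not w′)) + χ w + (χ (x′ ∧ (if x then not s else not w)) + χ w′)

pairWeight≤1 : ∀ x x′ w w′ s → (w ≡ true → x ≡ false) → (w′ ≡ true → x′ ≡ false) → (w ≡ true → w′ ≡ false)
  → pairWeight x x′ w w′ s ≤ 1
pairWeight≤1 true    true    false false true  _ _ _ = s≤s z≤n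
pairWeight≤1 true    true    false false false _ _ _ = s≤s z≤n
pairWeight≤1 true    false   false true  _     _ _ _ = s≤s z≤n
pairWeight≤1 true    false   false false _     _ _ _ = s≤s z≤n
pairWeight≤1 false   true    true  false _     _ _ _ = s≤s z≤n
pairWeight≤1 false   true    false false _     _ _ _ = s≤s z≤n
pairWeight≤1 false   false   true  false _     _ _ _ = s≤s z≤n
pairWeight≤1 false   false   false true  _     _ _ _ = s≤s z≤n
pairWeight≤1 false   false   false false _     _ _ _ = z≤n
pairWeight≤1 true    _       true  _     _     w⇒¬x _ _ = ⊥-elim (true≢false (w⇒¬x refl))
pairWeight≤1 _       true    _     true  _     _ w′⇒¬x′ _ = ⊥-elim (true≢false (w′⇒¬x′ refl))
pairWeight≤1 false   false   true  true  _     _ _ w⇒¬w′ = ⊥-elim (true≢false (w⇒¬w′ refl))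

pairWeight≥1 : ∀ x x′ w w′ s → (w ≡ true → x ≡ false) → (w′ ≡ true → x′ ≡ false) → (x ∨ w ∨ x′ ∨ w′) ≡ true
  → 1 ≤ pairWeight x x′ w w′ s
pairWeight≥1 true    true    false false true  _ _ _ = s≤s z≤n
pairWeight≥1 true    true    false false false _ _ _ = s≤s z≤n
pairWeight≥1 true    false   false true  _     _ _ _ = s≤s z≤n
pairWeight≥1 true    false   false false _     _ _ _ = s≤s z≤n
pairWeight≥1 false   true    true  false _     _ _ _ = s≤s z≤n
pairWeight≥1 false   true    false false _     _ _ _ = s≤s z≤n
pairWeight≥1 false   false   true  _     _     _ _ _ = s≤s z≤n
pairWeight≥1 false   false   false true  _     _ _ _ = s≤s z≤n
pairWeight≥1 true    _       true  _     _     w⇒¬x _ _ = ⊥-elim (true≢false (w⇒¬x refl))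
pairWeight≥1 _       true    _     true  _     _ w′⇒¬x′ _ = ⊥-elim (true≢false (w′⇒¬x′ refl))
pairWeight≥1 false   false   false false _     _ _ ()

pair-free-at : ∀ x x′ w w′ s i i′
  → (x ≡ true → i ≡ true → (if x′ then s else not w′) ≡ true)
  → (x ≡ false → i ≡ true → w ≡ true)
  → (x′ ≡ true → i′ ≡ true → (if x then not s else not w) ≡ true)
  → (x′ ≡ false → i′ ≡ true → w′ ≡ true)
  → (x ≡ false → x′ ≡ false → i ≡ true → i′ ≡ true → ⊥)
  → i ≡ true → i′ ≡ false
pair-free-at _ _ _ _ _ _ false _ _ _ _ _ _ = refl
pair-free-at true true _ _ s true true h _ h′ _ _ _ with s | h refl refl | h′ refl refl
... | true | _ | ()
... | false | () | _
pair-free-at true false _ w′ _ true true h _ _ g′ _ _ with w′ | h refl refl | g′ refl refl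
... | true | () | _
pair-free-at false true w _ _ true true _ g h′ _ _ _ with w | g refl refl | h′ refl refl
... | true | _ | ()
pair-free-at false false _ _ _ true true _ _ _ _ both _ = ⊥-elim (both refl refl refl refl)

χ-image-≥ : ∀ x i q → (x ≡ true → i ≡ q) → χ (x ∧ q) ≤ χ i
χ-image-≥ true i q i≡q rewrite i≡q refl = ≤-refl
χ-image-≥ false i q _ = z≤n

χ-image-≤ : ∀ x i q v → (x ≡ true → i ≡ q) → (x ≡ false → i ≡ true → v ≡ true) → χ i ≤ χ (x ∧ q) + χ v
χ-image-≤ true i q v i≡q _ rewrite i≡q refl = m≤m+n (χ q) (χ v)
χ-image-≤ false false q v _ _ = z≤n
χ-image-≤ false true q v _ i⇒v rewrite i⇒v refl refl = ≤-refl

module Witnesses {n : ℕ} (e : PosetEmbedding n) where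
  open PosetEmbedding e
  open Pairing n using (partner)

  image : Subset n → Fin (2 * n) → Bool
  image S = lookup (fun S)

  image-mono : ∀ S T → (∀ j → lookup S j ≡ true → lookup T j ≡ true) → ∀ a → image S a ≡ true → image T a ≡ true
  image-mono S T S⊆T a a∈fS =
    []=⇒lookup (monotone S T (λ {j} j∈S → lookup⇒[]= j T (S⊆T j ([]=⇒lookup j∈S))) (lookup⇒[]= a (fun S) a∈fS))

  private
    separates : Fin n → Fin (2 * n) → Set
    separates i a = a ∈ fun ⁅ i ⁆ × a ∉ fun (∁ ⁅ i ⁆)

    separator : ∀ i → ∃ (separates i)
    separator i with any? (λ a → (a ∈? fun ⁅ i ⁆) ×-dec ¬? (a ∈? fun (∁ ⁅ i ⁆)))
    ... | yes found = found
    ... | no none = ⊥-elim (x∈∁p⇒x∉p (reflects ⁅ i ⁆ (∁ ⁅ i ⁆) ⊆∁ (x∈⁅x⁆ i)) (x∈⁅x⁆ i))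
      where
      ⊆∁ : fun ⁅ i ⁆ ⊆ fun (∁ ⁅ i ⁆)
      ⊆∁ {a} a∈ with a ∈? fun (∁ ⁅ i ⁆)
      ... | yes a∈∁ = a∈∁
      ... | no a∉∁ = ⊥-elim (none (a , a∈ , a∉∁))

  witness : Fin n → Fin (2 * n)
  witness i = proj₁ (separator i)

  image-witness : ∀ S i → image S (witness i) ≡ lookup S i
  image-witness S i with lookup S i in i∈S | separator i
  ... | true | a , a∈f⁅i⁆ , _ = []=⇒lookup (monotone ⁅ i ⁆ S ⁅i⁆⊆S a∈f⁅i⁆)
    where
    ⁅i⁆⊆S : ⁅ i ⁆ ⊆ S
    ⁅i⁆⊆S j∈⁅i⁆ rewrite x∈⁅y⁆⇒x≡y i j∈⁅i⁆ = lookup⇒[]= i S i∈S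
  ... | false | a , _ , a∉f∁⁅i⁆ =
    ¬-not λ a∈fS → a∉f∁⁅i⁆ (monotone S (∁ ⁅ i ⁆) S⊆∁⁅i⁆ (lookup⇒[]= a (fun S) a∈fS))
    where
    S⊆∁⁅i⁆ : S ⊆ ∁ ⁅ i ⁆
    S⊆∁⁅i⁆ {j} j∈S = x∉p⇒x∈∁p λ j∈⁅i⁆ →
      true≢false (trans (sym (subst (λ k → lookup S k ≡ true) (x∈⁅y⁆⇒x≡y i j∈⁅i⁆) ([]=⇒lookup j∈S))) i∈S)

  witness-injective : ∀ i j → witness i ≡ witness j → i ≡ j
  witness-injective i j wi≡wj = x∈⁅y⁆⇒x≡y j (lookup⇒[]= i ⁅ j ⁆ (begin
    lookup ⁅ j ⁆ i             ≡⟨ image-witness ⁅ j ⁆ i ⟨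
    image ⁅ j ⁆ (witness i)    ≡⟨ cong (image ⁅ j ⁆) wi≡wj ⟩
    image ⁅ j ⁆ (witness j)    ≡⟨ image-witness ⁅ j ⁆ j ⟩
    lookup ⁅ j ⁆ j             ≡⟨ []=⇒lookup (x∈⁅x⁆ j) ⟩
    true                       ∎))
    where open ≡-Reasoning

  X : Fin (2 * n) → Bool
  X a = does (any? (λ i → witness i ≟ a))

  X-witness : ∀ i → X (witness i) ≡ true
  X-witness i with any? (λ j → witness j ≟ witness i)
  ... | yes _ = refl
  ... | no none = ⊥-elim (none (i , refl))

  X⇒witness : ∀ a → X a ≡ true → ∃ λ i → witness i ≡ a
  X⇒witness a Xa with any? (λ i → witness i ≟ a)
  X⇒witness a refl | yes found = found

  n≤card-X : n ≤ card X
  n≤card-X = begin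
    n                                       ≡⟨ sum-ones n ⟨
    sum {n} (λ _ → 1)                       ≡⟨ sum-cong-≗ (λ i → sum-δ (witness i)) ⟨
    sum (λ i → sum (δ (witness i)))         ≡⟨ ∑-comm (λ i → δ (witness i)) ⟩
    sum (λ a → sum (λ i → δ (witness i) a)) ≤⟨ sum-mono-≤ _ _ witnesses-at≤X ⟩
    card X                                  ∎
    where
    open ≤-Reasoning
    witnesses-at≤X : ∀ a → sum (λ i → δ (witness i) a) ≤ χ (X a)
    witnesses-at≤X a with X a in Xa
    ... | false = ≤-reflexive (sum-zero _ none)
      where
      none : ∀ i → δ (witness i) a ≡ 0
      none i with a ≟ witness i
      ... | yes refl = ⊥-elim (true≢false (trans (sym (X-witness i)) Xa))
      ... | no _ = refl
    ... | true with X⇒witness a Xa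
    ... | i , refl = ≤-reflexive (trans (sum-cong-≗ only-i) (sum-δ i))
      where
      only-i : ∀ j → δ (witness j) (witness i) ≡ δ i j
      only-i j with witness i ≟ witness j | j ≟ i
      ... | yes _ | yes _ = refl
      ... | no _ | no _ = refl
      ... | yes wi≡wj | no j≢i = ⊥-elim (j≢i (sym (witness-injective i j wi≡wj)))
      ... | no wi≢wj | yes refl = ⊥-elim (wi≢wj refl)

  preimage : (Fin (2 * n) → Bool) → Subset n
  preimage Q = tabulate (Q ∘ witness)

  image-preimage-X : ∀ Q a → X a ≡ true → image (preimage Q) a ≡ Q a
  image-preimage-X Q a Xa with X⇒witness a Xa
  ... | i , refl = trans (image-witness (preimage Q) i) (lookup∘tabulate _ i)

  image-preimage-mono : ∀ Q Q′ → (∀ a → Q a ≡ true → Q′ a ≡ true)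
    → ∀ a → image (preimage Q) a ≡ true → image (preimage Q′) a ≡ true
  image-preimage-mono Q Q′ Q⊆Q′ = image-mono (preimage Q) (preimage Q′) λ j Qj →
    trans (lookup∘tabulate _ j) (Q⊆Q′ (witness j) (trans (sym (lookup∘tabulate _ j)) Qj))

  full : Subset n
  full = preimage (λ _ → true)

  W : Fin (2 * n) → Bool
  W a = image full a ∧ not (X a)

  W⇒¬X : ∀ a → W a ≡ true → X a ≡ false
  W⇒¬X a Wa with X a
  ... | false = refl
  ... | true = ⊥-elim (true≢false (trans (sym Wa) (∧-zeroʳ (image full a))))

  X⇒¬W : ∀ a → X a ≡ true → W a ≡ false
  X⇒¬W a Xa = ¬-not λ Wa → true≢false (trans (sym Xa) (W⇒¬X a Wa))

  image-¬X⇒W : ∀ S a → X a ≡ false → image S a ≡ true → W a ≡ true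
  image-¬X⇒W S a ¬Xa a∈fS rewrite ¬Xa | image-mono S full (λ j _ → lookup∘tabulate _ j) a a∈fS = refl

  image-full : ∀ a → image full a ≡ (X a ∨ W a)
  image-full a with X a in Xa
  ... | true = image-preimage-X (λ _ → true) a Xa
  ... | false = sym (∧-identityʳ (image full a))

  NoPairOutsideX : Subset n → Set
  NoPairOutsideX S = ∀ a → X a ≡ false → X (partner a) ≡ false → image S a ≡ true → image S (partner a) ≡ true → ⊥

  size : Subset n → ℕ
  size S = card (image S)

  ∣fun∣≡size : ∀ S → ∣ fun S ∣ ≡ size S
  ∣fun∣≡size S = ∣∣≡card (fun S)

  size-full : size full ≡ card X + card W
  size-full = trans (sum-cong-≗ λ a → trans (cong χ (image-full a)) (χ-∨-disjoint (X a) (W a) (W⇒¬X a)))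
                    (∑-distrib-+ (χ ∘ X) (χ ∘ W))

  size-preimage-≥ : ∀ Q → card (λ a → X a ∧ Q a) ≤ size (preimage Q)
  size-preimage-≥ Q = sum-mono-≤ _ _ λ a → χ-image-≥ (X a) (image (preimage Q) a) (Q a) (image-preimage-X Q a)

  size-preimage-≤ : ∀ Q V → (∀ a → X a ≡ false → image (preimage Q) a ≡ true → V a ≡ true)
    → size (preimage Q) ≤ card (λ a → X a ∧ Q a) + card V
  size-preimage-≤ Q V outside⊆V = begin
    size (preimage Q)                          ≤⟨ sum-mono-≤ _ _ (λ a → χ-image-≤ (X a) (image (preimage Q) a) (Q a) (V a)
                                                                                (image-preimage-X Q a) (outside⊆V a)) ⟩
    sum (λ a → χ (X a ∧ Q a) + χ (V a))        ≡⟨ ∑-distrib-+ (λ a → χ (X a ∧ Q a)) (χ ∘ V) ⟩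
    card (λ a → X a ∧ Q a) + card V            ∎
    where open ≤-Reasoning

module Embedded (n : ℕ) (R : Subset (2 * n) → Set) (restrictive : Restrictive n R)
                (e : PosetEmbedding n) (f∈R : ∀ S → R (PosetEmbedding.fun e S)) where
  open Pairing n public
  open Witnesses e public
  open PosetEmbedding e

  PairFree : Subset n → Set
  PairFree S = ∀ a → image S a ≡ true → image S (partner a) ≡ false

  pairFree⇒size≥n : ∀ S → PairFree S → ⌈ n /2⌉ ≤ size S → n ≤ size S
  pairFree⇒size≥n S pf ⌈n/2⌉≤ with n ≤? size S
  ... | yes n≤ = n≤
  ... | no n≰ = ⊥-elim (¬HasPair (fun S) pf
          (proj₁ restrictive (fun S) (f∈R S) (subst (⌈ n /2⌉ ≤_) (sym (∣fun∣≡size S)) ⌈n/2⌉≤)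
                                            (subst (_< n) (sym (∣fun∣≡size S)) (≰⇒> n≰))))

  size≤n+⌊n/2⌋ : ∀ S → size S ≤ n + ⌊ n /2⌋
  size≤n+⌊n/2⌋ S = subst (_≤ n + ⌊ n /2⌋) (∣fun∣≡size S) (proj₁ (proj₂ (proj₂ restrictive)) (fun S) (f∈R S))

  size>n⇒meets-every-pair : ∀ S → n < size S → ∀ a → (image S a ∨ image S (partner a)) ≡ true
  size>n⇒meets-every-pair S n< a with image S a in a∈ | image S (partner a) in a′∈
  ... | true | _ = refl
  ... | false | true = refl
  ... | false | false = ⊥-elim (proj₁ (proj₂ restrictive) (fun S) (f∈R S) (subst (n <_) (sym (∣fun∣≡size S)) n<)
          (subst (_≤ n + ⌊ n /2⌋) (sym (∣fun∣≡size S)) (size≤n+⌊n/2⌋ S)) (missesPair (fun S) a a∈ a′∈))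

  misses-pair⇒size≤n : ∀ S a → image S a ≡ false → image S (partner a) ≡ false → size S ≤ n
  misses-pair⇒size≤n S a a∉ a′∉ with n <? size S
  ... | no n≮ = ≮⇒≥ n≮
  ... | yes n< = ⊥-elim (true≢false (trans (sym (size>n⇒meets-every-pair S n< a)) (cong₂ _∨_ a∉ a′∉)))

  card-W≤⌊n/2⌋ : card W ≤ ⌊ n /2⌋
  card-W≤⌊n/2⌋ = +-cancelˡ-≤ n (card W) ⌊ n /2⌋
    (≤-trans (+-monoˡ-≤ (card W) n≤card-X) (subst (_≤ n + ⌊ n /2⌋) size-full (size≤n+⌊n/2⌋ full)))

  X∪W-meets-every-pair : 1 ≤ card W → ∀ a → (X a ∨ W a ∨ X (partner a) ∨ W (partner a)) ≡ true
  X∪W-meets-every-pair 1≤W a = begin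
    X a ∨ W a ∨ X (partner a) ∨ W (partner a)          ≡⟨ ∨-assoc (X a) (W a) _ ⟨
    (X a ∨ W a) ∨ (X (partner a) ∨ W (partner a))      ≡⟨ cong₂ _∨_ (image-full a) (image-full (partner a)) ⟨
    image full a ∨ image full (partner a)              ≡⟨ size>n⇒meets-every-pair full n<size-full a ⟩
    true                                               ∎
    where
    open ≡-Reasoning
    n<size-full : n < size full
    n<size-full = subst (n <_) (sym size-full) (subst (_≤ card X + card W) (+-comm n 1) (+-mono-≤ n≤card-X 1≤W))

  -- Skipping the witnesses whose partner lies in W is what keeps images of preimage choice pair-free.
  module Choice (side : Fin (2 * n) → Bool) (side-partner : ∀ a → side (partner a) ≡ not (side a)) where

    choice : Fin (2 * n) → Bool
    choice a = if X (partner a) then side a else not (W (partner a))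

    choice-partner : ∀ a → choice (partner a) ≡ (if X a then not (side a) else not (W a))
    choice-partner a = trans (cong (λ b → if X b then side (partner a) else not (W b)) (partner-involutive a))
                             (cong (λ s → if X a then s else not (W a)) (side-partner a))

    Z : Fin (2 * n) → Bool
    Z a = X a ∧ choice a

    sum-pairWeight : sum (λ a → pairWeight (X a) (X (partner a)) (W a) (W (partner a)) (side a))
                   ≡ (card Z + card W) + (card Z + card W)
    sum-pairWeight = begin
      sum (λ a → pairWeight (X a) (X (partner a)) (W a) (W (partner a)) (side a)) ≡⟨ sum-cong-≗ weight-pair ⟨
      sum (λ a → weight a + weight (partner a))                                   ≡⟨ sum-pairs weight ⟩
      sum weight + sum weight                                                     ≡⟨ cong (λ s → s + s) (∑-distrib-+ (χ ∘ Z) (χ ∘ W)) ⟩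
      (card Z + card W) + (card Z + card W)                                       ∎
      where
      open ≡-Reasoning
      weight : Fin (2 * n) → ℕ
      weight a = χ (Z a) + χ (W a)
      weight-pair : ∀ a → weight a + weight (partner a) ≡ pairWeight (X a) (X (partner a)) (W a) (W (partner a)) (side a)
      weight-pair a = cong (λ c → weight a + (χ (X (partner a) ∧ c) + χ (W (partner a)))) (choice-partner a)

    preimage-pair-free-at : ∀ Q a → (Q a ≡ true → choice a ≡ true) → (Q (partner a) ≡ true → choice (partner a) ≡ true)
      → NoPairOutsideX (preimage Q) → image (preimage Q) a ≡ true → image (preimage Q) (partner a) ≡ false
    preimage-pair-free-at Q a Qa⇒ Qa′⇒ outside = pair-free-at (X a) (X (partner a)) (W a) (W (partner a)) (side a) _ _
      (λ Xa a∈ → Qa⇒ (trans (sym (image-preimage-X Q a Xa)) a∈))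
      (image-¬X⇒W (preimage Q) a)
      (λ Xa′ a′∈ → trans (sym (choice-partner a)) (Qa′⇒ (trans (sym (image-preimage-X Q (partner a) Xa′)) a′∈)))
      (image-¬X⇒W (preimage Q) (partner a))
      (outside a)

    preimage-pairFree : ∀ Q → (∀ a → Q a ≡ true → choice a ≡ true) → NoPairOutsideX (preimage Q) → PairFree (preimage Q)
    preimage-pairFree Q Q⊆choice outside a = preimage-pair-free-at Q a (Q⊆choice a) (Q⊆choice (partner a)) outside

  size-preimage-≢≤n : ∀ b → X b ≡ true → X (partner b) ≡ false → W (partner b) ≡ false
    → size (preimage (λ a → not (does (a ≟ b)))) ≤ n
  size-preimage-≢≤n b Xb ¬Xb′ ¬Wb′ = misses-pair⇒size≤n S b
    (trans (image-preimage-X (λ a → not (does (a ≟ b))) b Xb) (cong not (dec-true (b ≟ b) refl)))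
    (¬-not λ b′∈S → true≢false (trans (sym (image-¬X⇒W S (partner b) ¬Xb′ b′∈S)) ¬Wb′))
    where
    S : Subset n
    S = preimage (λ a → not (does (a ≟ b)))

  -- f S misses the pair of b, so it has at most one point outside X; restricting the even
  -- transversal to S therefore keeps its image pair-free, of size in [⌈n/2⌉, n).
  module LoneWitness (a₀ : Fin (2 * n)) (Wa₀ : W a₀ ≡ true) (Wa₀′ : W (partner a₀) ≡ true)
                     (b : Fin (2 * n)) (Xb : X b ≡ true) (¬Xb′ : X (partner b) ≡ false) (¬Wb′ : W (partner b) ≡ false) where
    open Choice even even-partner
    open ≤-Reasoning

    ≢b : Fin (2 * n) → Bool
    ≢b a = not (does (a ≟ b))

    S : Subset n
    S = preimage ≢b

    size-S≤n : size S ≤ n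
    size-S≤n = size-preimage-≢≤n b Xb ¬Xb′ ¬Wb′

    Y : Fin (2 * n) → Bool
    Y a = image S a ∧ not (X a)

    card-Y≤1 : card Y ≤ 1
    card-Y≤1 = +-cancelˡ-≤ n (card Y) 1 (begin
      n + card Y                          ≤⟨ +-monoˡ-≤ (card Y) n≤card-X ⟩
      card X + card Y                     ≡⟨ ∑-distrib-+ (χ ∘ X) (χ ∘ Y) ⟨
      sum (λ a → χ (X a) + χ (Y a))       ≤⟨ sum-mono-≤ _ _ (λ a → X+Y≤S+δ (X a) (image S a) (does (a ≟ b))
                                                                      (image-preimage-X ≢b a)) ⟩
      sum (λ a → χ (image S a) + δ b a)   ≡⟨ sum-+-δ (χ ∘ image S) b ⟩
      size S + 1                          ≤⟨ +-monoˡ-≤ 1 size-S≤n ⟩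
      n + 1                               ∎)
      where
      X+Y≤S+δ : ∀ x i d → (x ≡ true → i ≡ not d) → χ x + χ (i ∧ not x) ≤ χ i + χ d
      X+Y≤S+δ true i true i≡ rewrite i≡ refl = s≤s z≤n
      X+Y≤S+δ true i false i≡ rewrite i≡ refl = s≤s z≤n
      X+Y≤S+δ false i d _ rewrite ∧-identityʳ i = m≤m+n (χ i) (χ d)

    choice′ : Fin (2 * n) → Bool
    choice′ a = choice a ∧ ≢b a

    E′ : Subset n
    E′ = preimage choice′

    outside-E′⊆Y : ∀ a → X a ≡ false → image E′ a ≡ true → Y a ≡ true
    outside-E′⊆Y a ¬Xa a∈ = cong₂ _∧_ (image-preimage-mono choice′ ≢b (λ _ q → proj₂ (∧-true q)) a a∈) (cong not ¬Xa)

    E′-pairFree : PairFree E′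
    E′-pairFree = preimage-pairFree choice′ (λ _ q → proj₁ (∧-true q)) λ a ¬Xa ¬Xa′ a∈ a′∈ →
      <⇒≱ (s≤s (s≤s z≤n)) (≤-trans (card≥2 Y a (partner a) (outside-E′⊆Y a ¬Xa a∈) (outside-E′⊆Y (partner a) ¬Xa′ a′∈)
                                           (partner-≢ a)) card-Y≤1)

    Z′ : Fin (2 * n) → Bool
    Z′ a = X a ∧ choice′ a

    card-Z′+1≡card-Z : card Z′ + 1 ≡ card Z
    card-Z′+1≡card-Z = trans (cong (_+ 1) (sum-cong-≗ λ a → cong χ (sym (Bool.∧-assoc (X a) (choice a) (≢b a)))))
                             (card-remove Z b Zb)
      where
      Zb : Z b ≡ true
      Zb = cong₂ _∧_ Xb (trans (cong (λ x → if x then even b else not (W (partner b))) ¬Xb′) (cong not ¬Wb′))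

    n<card-Z+card-W : n < card Z + card W
    n<card-Z+card-W = m+m<n+n⇒m<n _ _ (begin-strict
      n + n                                                                         ≡⟨ sum-ones-pairs ⟨
      sum {2 * n} (λ _ → 1)                                                         <⟨ sum-mono-< _ _ (λ a →
        pairWeight≥1 (X a) (X (partner a)) (W a) (W (partner a)) (even a) (W⇒¬X a) (W⇒¬X (partner a))
                     (X∪W-meets-every-pair (card≥1 W a₀ Wa₀) a)) a₀
        (W-pair-weight (X a₀) (X (partner a₀)) (W a₀) (W (partner a₀)) (even a₀)
                       (W⇒¬X a₀ Wa₀) (W⇒¬X (partner a₀) Wa₀′) Wa₀ Wa₀′) ⟩
      sum (λ a → pairWeight (X a) (X (partner a)) (W a) (W (partner a)) (even a))   ≡⟨ sum-pairWeight ⟩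
      (card Z + card W) + (card Z + card W)                                         ∎)
      where
      W-pair-weight : ∀ x x′ w w′ s → x ≡ false → x′ ≡ false → w ≡ true → w′ ≡ true → 1 < pairWeight x x′ w w′ s
      W-pair-weight false false true true _ refl refl refl refl = s≤s (s≤s z≤n)

    card-Z<n : card Z < n
    card-Z<n = m+m<n+n⇒m<n _ _ (begin-strict
      card Z + card Z                             ≡⟨ sum-pairs (χ ∘ Z) ⟨
      sum (λ a → χ (Z a) + χ (Z (partner a)))     <⟨ sum-mono-< _ _ Z-pair≤1 a₀ Z-pair₀<1 ⟩
      sum {2 * n} (λ _ → 1)                       ≡⟨ sum-ones-pairs ⟩
      n + n                                       ∎)
      where
      at-most-one : ∀ x x′ w w′ s → χ (x ∧ (if x′ then s else not w′)) + χ (x′ ∧ (if x then not s else not w)) ≤ 1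
      at-most-one true true _ _ true = s≤s z≤n
      at-most-one true true _ _ false = s≤s z≤n
      at-most-one true false _ w′ _ = ≤-trans (≤-reflexive (+-identityʳ _)) (χ≤1 (not w′))
      at-most-one false x′ _ _ _ = χ≤1 _
      Z-pair≤1 : ∀ a → χ (Z a) + χ (Z (partner a)) ≤ 1
      Z-pair≤1 a rewrite choice-partner a = at-most-one (X a) (X (partner a)) (W a) (W (partner a)) (even a)
      Z-pair₀<1 : χ (Z a₀) + χ (Z (partner a₀)) < 1
      Z-pair₀<1 = subst (_< 1) (sym (cong₂ (λ x x′ → χ (x ∧ choice a₀) + χ (x′ ∧ choice (partner a₀)))
                                           (W⇒¬X a₀ Wa₀) (W⇒¬X (partner a₀) Wa₀′))) (s≤s z≤n)

    size-E′<n : size E′ < n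
    size-E′<n = begin-strict
      size E′               ≤⟨ size-preimage-≤ choice′ Y outside-E′⊆Y ⟩
      card Z′ + card Y      ≤⟨ +-monoʳ-≤ (card Z′) card-Y≤1 ⟩
      card Z′ + 1           ≡⟨ card-Z′+1≡card-Z ⟩
      card Z                <⟨ card-Z<n ⟩
      n                     ∎

    ⌈n/2⌉≤size-E′ : ⌈ n /2⌉ ≤ size E′
    ⌈n/2⌉≤size-E′ = ≤-trans (+-cancelʳ-≤ 1 ⌈ n /2⌉ (card Z′)
      (n+d≤z+w⇒⌈n/2⌉+d≤z n (card Z′ + 1) (card W) 1 (begin
        n + 1                   ≡⟨ +-comm n 1 ⟩
        suc n                   ≤⟨ n<card-Z+card-W ⟩
        card Z + card W         ≡⟨ cong (_+ card W) card-Z′+1≡card-Z ⟨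
        card Z′ + 1 + card W    ∎) card-W≤⌊n/2⌋))
      (size-preimage-≥ choice′)

    absurd : ⊥
    absurd = <⇒≱ size-E′<n (pairFree⇒size≥n E′ E′-pairFree ⌈n/2⌉≤size-E′)

  -- With W counted twice every pair weighs at least 2 and {a₀, a₀′} weighs 4, so card X + 2 card W
  -- exceeds 2n, which is incompatible with card X + card W ≤ n + ⌊n/2⌋ and n ≤ card X.
  module PartneredLoneWitnesses (a₀ : Fin (2 * n)) (Wa₀ : W a₀ ≡ true) (Wa₀′ : W (partner a₀) ≡ true)
    (lone⇒W : ∀ b → X b ≡ true → X (partner b) ≡ false → W (partner b) ≡ true) where
    open ≤-Reasoning

    weight : Fin (2 * n) → ℕ
    weight a = χ (X a) + 2 * χ (W a)

    weight-pair≥2 : ∀ a → 2 ≤ weight a + weight (partner a)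
    weight-pair≥2 a = pair≥2 (X a) (X (partner a)) (W a) (W (partner a))
      (W⇒¬X a) (W⇒¬X (partner a)) (X∪W-meets-every-pair (card≥1 W a₀ Wa₀) a) (lone⇒W a)
      (λ Xa′ ¬Xa → trans (cong W (sym (partner-involutive a))) (lone⇒W (partner a) Xa′ (trans (cong X (partner-involutive a)) ¬Xa)))
      where
      pair≥2 : ∀ x x′ w w′ → (w ≡ true → x ≡ false) → (w′ ≡ true → x′ ≡ false) → (x ∨ w ∨ x′ ∨ w′) ≡ true
        → (x ≡ true → x′ ≡ false → w′ ≡ true) → (x′ ≡ true → x ≡ false → w ≡ true)
        → 2 ≤ χ x + 2 * χ w + (χ x′ + 2 * χ w′)
      pair≥2 true  true  false false _ _ _ _ _ = s≤s (s≤s z≤n)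
      pair≥2 true  false false true  _ _ _ _ _ = s≤s (s≤s z≤n)
      pair≥2 false true  true  false _ _ _ _ _ = s≤s (s≤s z≤n)
      pair≥2 false false true  _     _ _ _ _ _ = s≤s (s≤s z≤n)
      pair≥2 false false false true  _ _ _ _ _ = s≤s (s≤s z≤n)
      pair≥2 true  _     true  _     w⇒¬x _ _ _ _ = ⊥-elim (true≢false (w⇒¬x refl))
      pair≥2 _     true  _     true  _ w′⇒¬x′ _ _ _ = ⊥-elim (true≢false (w′⇒¬x′ refl))
      pair≥2 true  false false false _ _ _ lone _ = ⊥-elim (true≢false (sym (lone refl refl)))
      pair≥2 false true  false false _ _ _ _ lone′ = ⊥-elim (true≢false (sym (lone′ refl refl)))
      pair≥2 false false false false _ _ () _ _

    weight-pair₀>2 : 2 < weight a₀ + weight (partner a₀)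
    weight-pair₀>2 = W-pair (X a₀) (X (partner a₀)) (W a₀) (W (partner a₀))
                            (W⇒¬X a₀ Wa₀) (W⇒¬X (partner a₀) Wa₀′) Wa₀ Wa₀′
      where
      W-pair : ∀ x x′ w w′ → x ≡ false → x′ ≡ false → w ≡ true → w′ ≡ true
        → 2 < χ x + 2 * χ w + (χ x′ + 2 * χ w′)
      W-pair false false true true refl refl refl refl = s≤s (s≤s (s≤s z≤n))

    n+n<card-X+2*card-W : n + n < card X + 2 * card W
    n+n<card-X+2*card-W = m+m<n+n⇒m<n _ _ (begin-strict
      (n + n) + (n + n)                                ≡⟨ cong (λ s → s + s) sum-ones-pairs ⟨
      sum {2 * n} (λ _ → 1) + sum {2 * n} (λ _ → 1)    ≡⟨ ∑-distrib-+ {2 * n} (λ _ → 1) (λ _ → 1) ⟨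
      sum {2 * n} (λ _ → 2)                            <⟨ sum-mono-< _ _ weight-pair≥2 a₀ weight-pair₀>2 ⟩
      sum (λ a → weight a + weight (partner a))        ≡⟨ sum-pairs weight ⟩
      sum weight + sum weight                          ≡⟨ cong (λ s → s + s) weight-sum ⟩
      (card X + 2 * card W) + (card X + 2 * card W)    ∎)
      where
      weight-sum : sum weight ≡ card X + 2 * card W
      weight-sum = trans (∑-distrib-+ (χ ∘ X) (λ a → 2 * χ (W a))) (cong (card X +_) (sym (*-distribˡ-sum 2 (χ ∘ W))))

    absurd : ⊥
    absurd = <⇒≱ (begin-strict
      (n + ⌊ n /2⌋) + (n + ⌊ n /2⌋)          ≡⟨ regroup n ⌊ n /2⌋ ⟩
      n + n + (⌊ n /2⌋ + ⌊ n /2⌋)            ≤⟨ +-monoʳ-≤ (n + n) ⌊n/2⌋+⌊n/2⌋≤n ⟩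
      n + n + n                              ≡⟨ +-comm (n + n) n ⟩
      n + (n + n)                            <⟨ +-mono-≤-< n≤card-X n+n<card-X+2*card-W ⟩
      card X + (card X + 2 * card W)         ≡⟨ split-2* (card X) (card W) ⟩
      (card X + card W) + (card X + card W)  ∎)
      (+-mono-≤ X+W≤n+⌊n/2⌋ X+W≤n+⌊n/2⌋)
      where
      regroup : ∀ a b → (a + b) + (a + b) ≡ a + a + (b + b)
      regroup = solve-∀
      split-2* : ∀ x w → x + (x + 2 * w) ≡ (x + w) + (x + w)
      split-2* = solve-∀
      X+W≤n+⌊n/2⌋ : card X + card W ≤ n + ⌊ n /2⌋
      X+W≤n+⌊n/2⌋ = subst (_≤ n + ⌊ n /2⌋) size-full (size≤n+⌊n/2⌋ full)
      ⌊n/2⌋+⌊n/2⌋≤n : ⌊ n /2⌋ + ⌊ n /2⌋ ≤ n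
      ⌊n/2⌋+⌊n/2⌋≤n = ≤-trans (+-monoʳ-≤ ⌊ n /2⌋ (⌊n/2⌋≤⌈n/2⌉ n)) (≤-reflexive (⌊n/2⌋+⌈n/2⌉≡n n))

  W-pair-free : ∀ a → W a ≡ true → W (partner a) ≡ false
  W-pair-free a Wa = ¬-not λ Wa′ → lone-witness-cases a Wa Wa′
    where
    lone-witness-cases : ∀ a → W a ≡ true → W (partner a) ≡ true → ⊥
    lone-witness-cases a Wa Wa′
      with any? (λ b → (X b Bool.≟ true) ×-dec ((X (partner b) Bool.≟ false) ×-dec (W (partner b) Bool.≟ false)))
    ... | yes (b , Xb , ¬Xb′ , ¬Wb′) = LoneWitness.absurd a Wa Wa′ b Xb ¬Xb′ ¬Wb′
    ... | no none = PartneredLoneWitnesses.absurd a Wa Wa′ λ b Xb ¬Xb′ → ¬-not λ ¬Wb′ → none (b , Xb , ¬Xb′ , ¬Wb′)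

  outside-X-pair-free : ∀ S → NoPairOutsideX S
  outside-X-pair-free S a ¬Xa ¬Xa′ a∈ a′∈ =
    true≢false (trans (sym (image-¬X⇒W S (partner a) ¬Xa′ a′∈)) (W-pair-free a (image-¬X⇒W S a ¬Xa a∈)))

  module Transversal (side : Fin (2 * n) → Bool) (side-partner : ∀ a → side (partner a) ≡ not (side a)) where
    open Choice side side-partner public

    E : Subset n
    E = preimage choice

    E-pairFree : PairFree E
    E-pairFree = preimage-pairFree choice (λ _ c → c) (outside-X-pair-free E)

    card-Z+card-W≤n : card Z + card W ≤ n
    card-Z+card-W≤n = m+m≤n+n⇒m≤n _ _ (begin
      (card Z + card W) + (card Z + card W)                                         ≡⟨ sum-pairWeight ⟨
      sum (λ a → pairWeight (X a) (X (partner a)) (W a) (W (partner a)) (side a))   ≤⟨ sum-mono-≤ _ _ (λ a →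
        pairWeight≤1 (X a) (X (partner a)) (W a) (W (partner a)) (side a) (W⇒¬X a) (W⇒¬X (partner a)) (W-pair-free a)) ⟩
      sum {2 * n} (λ _ → 1)                                                         ≡⟨ sum-ones-pairs ⟩
      n + n                                                                         ∎)
      where open ≤-Reasoning

    ⌈n/2⌉≤card-Z : ⌈ n /2⌉ ≤ card Z
    ⌈n/2⌉≤card-Z with 1 ≤? card W
    ... | yes 1≤W = subst (_≤ card Z) (+-identityʳ _)
      (n+d≤z+w⇒⌈n/2⌉+d≤z n (card Z) (card W) 0 (subst (_≤ card Z + card W) (sym (+-identityʳ n)) n≤Z+W) card-W≤⌊n/2⌋)
      where
      open ≤-Reasoning
      n≤Z+W : n ≤ card Z + card W
      n≤Z+W = m+m≤n+n⇒m≤n _ _ (begin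
        n + n                                                                         ≡⟨ sum-ones-pairs ⟨
        sum {2 * n} (λ _ → 1)                                                         ≤⟨ sum-mono-≤ _ _ (λ a →
          pairWeight≥1 (X a) (X (partner a)) (W a) (W (partner a)) (side a) (W⇒¬X a) (W⇒¬X (partner a))
                       (X∪W-meets-every-pair 1≤W a)) ⟩
        sum (λ a → pairWeight (X a) (X (partner a)) (W a) (W (partner a)) (side a))   ≡⟨ sum-pairWeight ⟩
        (card Z + card W) + (card Z + card W)                                         ∎)
    ... | no 1≰W = n≤m+m⇒⌈n/2⌉≤m n (card Z) (m+m≤n+n⇒m≤n _ _ (begin
      n + n                                              ≤⟨ +-mono-≤ n≤card-X n≤card-X ⟩
      card X + card X                                    ≡⟨ sum-pairs (χ ∘ X) ⟨
      sum (λ a → χ (X a) + χ (X (partner a)))            ≤⟨ sum-mono-≤ _ _ X-pair≤2*Z-pair ⟩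
      sum (λ a → 2 * (χ (Z a) + χ (Z (partner a))))      ≡⟨ *-distribˡ-sum 2 (λ a → χ (Z a) + χ (Z (partner a))) ⟨
      2 * sum (λ a → χ (Z a) + χ (Z (partner a)))        ≡⟨ cong (2 *_) (sum-pairs (χ ∘ Z)) ⟩
      2 * (card Z + card Z)                              ≡⟨ cong (card Z + card Z +_) (+-identityʳ _) ⟩
      (card Z + card Z) + (card Z + card Z)              ∎))
      where
      open ≤-Reasoning
      W-empty : ∀ a → W a ≡ false
      W-empty = card-0 W (n≤0⇒n≡0 (≮⇒≥ 1≰W))
      two-witnesses : ∀ x x′ s
        → χ x + χ x′ ≤ 2 * (χ (x ∧ (if x′ then s else true)) + χ (x′ ∧ (if x then not s else true)))
      two-witnesses true true true = s≤s (s≤s z≤n)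
      two-witnesses true true false = s≤s (s≤s z≤n)
      two-witnesses true false _ = s≤s z≤n
      two-witnesses false true _ = s≤s z≤n
      two-witnesses false false _ = z≤n
      X-pair≤2*Z-pair : ∀ a → χ (X a) + χ (X (partner a)) ≤ 2 * (χ (Z a) + χ (Z (partner a)))
      X-pair≤2*Z-pair a rewrite choice-partner a | W-empty a | W-empty (partner a) = two-witnesses (X a) (X (partner a)) (side a)

    E-size-bounds : card Z ≤ size E × size E ≤ card Z + card W
    E-size-bounds = size-preimage-≥ choice , size-preimage-≤ choice W (image-¬X⇒W E)

    n≤size-E : n ≤ size E
    n≤size-E = pairFree⇒size≥n E E-pairFree (≤-trans ⌈n/2⌉≤card-Z (proj₁ E-size-bounds))

    size-E≡n : size E ≡ n
    size-E≡n = ≤-antisym (≤-trans (proj₂ E-size-bounds) card-Z+card-W≤n) n≤size-E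

    card-Z+card-W≡n : card Z + card W ≡ n
    card-Z+card-W≡n = ≤-antisym card-Z+card-W≤n (≤-trans n≤size-E (proj₂ E-size-bounds))

    image-E : ∀ a → image E a ≡ (Z a ∨ W a)
    image-E a = χ-additive (image E a) (Z a) (W a) (λ Wa → cong (_∧ choice a) (W⇒¬X a Wa))
      (sum-≥⇒≗ (χ ∘ image E) (λ a → χ (Z a) + χ (W a)) pointwise
               (≤-trans (≤-reflexive (trans (∑-distrib-+ (χ ∘ Z) (χ ∘ W)) card-Z+card-W≡n)) n≤size-E) a)
      where
      pointwise : ∀ a → χ (image E a) ≤ χ (Z a) + χ (W a)
      pointwise a = χ-image-≤ (X a) (image E a) (choice a) (W a) (image-preimage-X choice a) (image-¬X⇒W E a)
      χ-additive : ∀ i z w → (w ≡ true → z ≡ false) → χ i ≡ χ z + χ w → i ≡ (z ∨ w)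
      χ-additive true true _ _ _ = refl
      χ-additive true false true _ _ = refl
      χ-additive false false false _ _ = refl
      χ-additive false true _ _ ()
      χ-additive false false true _ ()
      χ-additive true false false _ ()

    image-E-X-pair : ∀ a → X a ≡ true → X (partner a) ≡ true → image E a ≡ side a
    image-E-X-pair a Xa Xa′ = trans (image-E a) (side-wins (X a) (X (partner a)) (W a) Xa Xa′ (X⇒¬W a Xa))
      where
      side-wins : ∀ x x′ w {s t} → x ≡ true → x′ ≡ true → w ≡ false → ((x ∧ (if x′ then s else t)) ∨ w) ≡ s
      side-wins true true false {s} refl refl refl = ∨-identityʳ s

  module Flip (c : Fin (2 * n)) (Xc : X c ≡ true) (Xc′ : X (partner c) ≡ true) (odd-c : even c ≡ false) where

    at-c : Fin (2 * n) → Bool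
    at-c a = does (a ≟ c) ∨ does (a ≟ partner c)

    -- Flipping the side on {c, c′} alone makes the two transversal images differ only there.
    side′ : Fin (2 * n) → Bool
    side′ a = if at-c a then not (even a) else even a

    side′-partner : ∀ a → side′ (partner a) ≡ not (side′ a)
    side′-partner a = trans (cong₂ (λ f s → if f then not s else s) at-c-partner (even-partner a))
                            (sym (Bool.if-float not (at-c a)))
      where
      at-c-partner : at-c (partner a) ≡ at-c a
      at-c-partner = trans (cong₂ _∨_ (≟-partner a c) (≟-partner-partner a c)) (∨-comm (does (a ≟ partner c)) _)

    module A = Transversal even even-partner
    module B = Transversal side′ side′-partner

    A-c : image A.E c ≡ false
    A-c = trans (A.image-E-X-pair c Xc Xc′) odd-c

    B-c : image B.E c ≡ true
    B-c = trans (B.image-E-X-pair c Xc Xc′)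
      (trans (cong (λ f → if f ∨ does (c ≟ partner c) then not (even c) else even c) (dec-true (c ≟ c) refl)) (cong not odd-c))

    A-c′ : image A.E (partner c) ≡ true
    A-c′ = trans (A.image-E-X-pair (partner c) Xc′ (trans (cong X (partner-involutive c)) Xc))
                 (trans (even-partner c) (cong not odd-c))

    B≡A-elsewhere : ∀ a → a ≢ c → a ≢ partner c → image B.E a ≡ image A.E a
    B≡A-elsewhere a a≢c a≢c′ = begin
      image B.E a           ≡⟨ B.image-E a ⟩
      image-with (side′ a)  ≡⟨ cong image-with side′≡even ⟩
      image-with (even a)   ≡⟨ A.image-E a ⟨
      image A.E a           ∎
      where
      open ≡-Reasoning
      image-with : Bool → Bool
      image-with s = (X a ∧ (if X (partner a) then s else not (W (partner a)))) ∨ W a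
      side′≡even : side′ a ≡ even a
      side′≡even = cong (λ f → if f then not (even a) else even a)
                        (cong₂ _∨_ (dec-false (a ≟ c) a≢c) (dec-false (a ≟ partner c) a≢c′))

    union-pointwise : ∀ a → χ (image A.E a ∨ image B.E a) ≡ χ (image A.E a) + δ c a
    union-pointwise a with a ≟ c | a ≟ partner c
    ... | yes refl | _ = trans (cong₂ (λ u v → χ (u ∨ v)) A-c B-c)
                               (sym (cong (λ u → χ u + 1) A-c))
    ... | no a≢c | yes refl = trans (cong (λ u → χ (u ∨ image B.E (partner c))) A-c′)
                                    (sym (cong (λ u → χ u + 0) A-c′))
    ... | no a≢c | no a≢c′ = begin
      χ (image A.E a ∨ image B.E a)   ≡⟨ cong (λ v → χ (image A.E a ∨ v)) (B≡A-elsewhere a a≢c a≢c′) ⟩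
      χ (image A.E a ∨ image A.E a)   ≡⟨ cong χ (∨-idem (image A.E a)) ⟩
      χ (image A.E a)                 ≡⟨ +-identityʳ _ ⟨
      χ (image A.E a) + 0             ∎
      where open ≡-Reasoning

    size-union : ∣ fun A.E ∪ fun B.E ∣ ≡ n + 1
    size-union = begin
      ∣ fun A.E ∪ fun B.E ∣                         ≡⟨ ∣∣≡card (fun A.E ∪ fun B.E) ⟩
      card (lookup (fun A.E ∪ fun B.E))            ≡⟨ sum-cong-≗ (λ a → cong χ (lookup-zipWith _∨_ a (fun A.E) (fun B.E))) ⟩
      sum (λ a → χ (image A.E a ∨ image B.E a))    ≡⟨ sum-cong-≗ union-pointwise ⟩
      sum (λ a → χ (image A.E a) + δ c a)          ≡⟨ sum-+-δ (χ ∘ image A.E) c ⟩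
      size A.E + 1                                 ≡⟨ cong (_+ 1) A.size-E≡n ⟩
      n + 1                                        ∎
      where open ≡-Reasoning

    absurd : ⊥
    absurd = proj₂ (proj₂ (proj₂ restrictive)) (fun A.E) (fun B.E)
      (trans (∣fun∣≡size A.E) A.size-E≡n) (trans (∣fun∣≡size B.E) B.size-E≡n) size-union
      (¬HasPair (fun A.E) A.E-pairFree) (¬HasPair (fun B.E) B.E-pairFree) (f∈R A.E , f∈R B.E)

  X-pair-free : ∀ b → X b ≡ true → X (partner b) ≡ false
  X-pair-free b Xb = ¬-not λ Xb′ → odd-end b Xb Xb′ (even b) refl
    where
    odd-end : ∀ b → X b ≡ true → X (partner b) ≡ true → ∀ e → even b ≡ e → ⊥
    odd-end b Xb Xb′ false odd-b = Flip.absurd b Xb Xb′ odd-b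
    odd-end b Xb Xb′ true even-b = Flip.absurd (partner b) Xb′ (trans (cong X (partner-involutive b)) Xb)
                                                 (trans (even-partner b) (cong not even-b))

  module Pivot (4≤n : 4 ≤ n) where
    open Transversal even even-partner

    pivot : ∃ λ b → Z b ≡ true
    pivot = card-pos Z (≤-trans (≤-trans (s≤s z≤n) (⌈n/2⌉-mono 4≤n)) ⌈n/2⌉≤card-Z)

    b : Fin (2 * n)
    b = proj₁ pivot

    Xb : X b ≡ true
    Xb = proj₁ (∧-true (proj₂ pivot))

    choice-b : choice b ≡ true
    choice-b = proj₂ (∧-true (proj₂ pivot))

    ¬Xb′ : X (partner b) ≡ false
    ¬Xb′ = X-pair-free b Xb

    ¬Wb′ : W (partner b) ≡ false
    ¬Wb′ = trans (sym (Bool.not-involutive _))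
                 (cong not (trans (sym (cong (λ x → if x then even b else not (W (partner b))) ¬Xb′)) choice-b))

    ≢b : Fin (2 * n) → Bool
    ≢b a = not (does (a ≟ b))

    choice∖b : Fin (2 * n) → Bool
    choice∖b a = choice a ∧ ≢b a

    card-Z∖b : card (λ a → X a ∧ choice∖b a) + 1 ≡ card Z
    card-Z∖b = trans (cong (_+ 1) (sum-cong-≗ λ a → cong χ (sym (Bool.∧-assoc (X a) (choice a) (≢b a)))))
                     (card-remove Z b (proj₂ pivot))

    E∖b : Subset n
    E∖b = preimage choice∖b

    size-E∖b<n : size E∖b < n
    size-E∖b<n = subst (_≤ n) (+-comm (size E∖b) 1) (begin
      size E∖b + 1                                 ≤⟨ +-monoˡ-≤ 1 (size-preimage-≤ choice∖b W (image-¬X⇒W E∖b)) ⟩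
      card (λ a → X a ∧ choice∖b a) + card W + 1   ≡⟨ regroup (card (λ a → X a ∧ choice∖b a)) (card W) ⟩
      card (λ a → X a ∧ choice∖b a) + 1 + card W   ≡⟨ cong (_+ card W) card-Z∖b ⟩
      card Z + card W                              ≡⟨ card-Z+card-W≡n ⟩
      n                                            ∎)
      where
      open ≤-Reasoning
      regroup : ∀ z w → z + w + 1 ≡ z + 1 + w
      regroup = solve-∀

    W≤1⇒⌈n/2⌉≤size-E∖b : card W ≤ 1 → ⌈ n /2⌉ ≤ size E∖b
    W≤1⇒⌈n/2⌉≤size-E∖b W≤1 = ≤-trans (+-cancelʳ-≤ 2 ⌈ n /2⌉ _ (begin
      ⌈ n /2⌉ + 2                                  ≤⟨ +-monoʳ-≤ ⌈ n /2⌉ (⌊n/2⌋-mono 4≤n) ⟩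
      ⌈ n /2⌉ + ⌊ n /2⌋                            ≡⟨ +-comm ⌈ n /2⌉ ⌊ n /2⌋ ⟩
      ⌊ n /2⌋ + ⌈ n /2⌉                            ≡⟨ ⌊n/2⌋+⌈n/2⌉≡n n ⟩
      n                                            ≡⟨ card-Z+card-W≡n ⟨
      card Z + card W                              ≤⟨ +-monoʳ-≤ (card Z) W≤1 ⟩
      card Z + 1                                   ≡⟨ cong (_+ 1) card-Z∖b ⟨
      card (λ a → X a ∧ choice∖b a) + 1 + 1        ≡⟨ +-assoc _ 1 1 ⟩
      card (λ a → X a ∧ choice∖b a) + 2            ∎)) (size-preimage-≥ choice∖b)
      where open ≤-Reasoning

    2≤card-W : 2 ≤ card W
    2≤card-W with 2 ≤? card W
    ... | yes 2≤W = 2≤W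
    ... | no 2≰W = ⊥-elim (<⇒≱ size-E∖b<n (pairFree⇒size≥n E∖b
                     (preimage-pairFree choice∖b (λ _ q → proj₁ (∧-true q)) (outside-X-pair-free E∖b))
                     (W≤1⇒⌈n/2⌉≤size-E∖b (s≤s⁻¹ (≰⇒> 2≰W)))))

    W⇒X-partner : ∀ w → W w ≡ true → X (partner w) ≡ true
    W⇒X-partner w Ww = ¬-not λ ¬Xw′ → <⇒≱ (m+m<n+n⇒m<n (card X) n (begin-strict
      card X + card X                          ≡⟨ sum-pairs (χ ∘ X) ⟨
      sum (λ a → χ (X a) + χ (X (partner a)))  <⟨ sum-mono-< _ _ (λ a → at-most-one (X a) (X (partner a)) (X-pair-free a)) w
                                                    (subst (_< 1) (sym (cong₂ (λ u v → χ u + χ v) (W⇒¬X w Ww) ¬Xw′)) (s≤s z≤n)) ⟩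
      sum {2 * n} (λ _ → 1)                    ≡⟨ sum-ones-pairs ⟩
      n + n                                    ∎)) n≤card-X
      where
      open ≤-Reasoning
      at-most-one : ∀ u v → (u ≡ true → v ≡ false) → χ u + χ v ≤ 1
      at-most-one true v u⇒¬v rewrite u⇒¬v refl = ≤-refl
      at-most-one false v _ = χ≤1 v

    -- Q trades b for the partner k of w; were w outside f (preimage Q), that image would be pair-free
    -- of size card Z + card W − 1 = n − 1.
    module Covering (w : Fin (2 * n)) (Ww : W w ≡ true) where
      k : Fin (2 * n)
      k = partner w

      Xk : X k ≡ true
      Xk = W⇒X-partner w Ww

      k≢b : k ≢ b
      k≢b k≡b = true≢false (trans (sym Ww) (trans (cong W (sym (partner-involutive w))) (trans (cong (W ∘ partner) k≡b) ¬Wb′)))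

      choice-k : choice k ≡ false
      choice-k = trans (cong (λ a → if X a then even k else not (W a)) (partner-involutive w))
                       (trans (cong (λ x → if x then even k else not (W w)) (W⇒¬X w Ww)) (cong not Ww))

      Q : Fin (2 * n) → Bool
      Q a = choice∖b a ∨ does (a ≟ k)

      Q⊆≢b : ∀ a → Q a ≡ true → ≢b a ≡ true
      Q⊆≢b a Qa with does (a ≟ k) in ak
      ... | true = trans (cong ≢b (does-≟⇒≡ a k ak)) (cong not (dec-false (k ≟ b) k≢b))
      ... | false = proj₂ (∧-true (trans (sym (∨-identityʳ _)) Qa))

      S : Subset n
      S = preimage Q

      card-XQ : card (λ a → X a ∧ Q a) ≡ card Z
      card-XQ = +-cancelʳ-≡ 1 _ _ (begin
        card (λ a → X a ∧ Q a) + 1                ≡⟨ sum-+-δ (λ a → χ (X a ∧ Q a)) b ⟨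
        sum (λ a → χ (X a ∧ Q a) + δ b a)         ≡⟨ sum-cong-≗ (λ a → swap-b-for-k (X a) (choice a) (does (a ≟ k)) (does (a ≟ b))
                                                       (at-k a) (at-b a)) ⟩
        sum (λ a → χ (Z a) + δ k a)               ≡⟨ sum-+-δ (χ ∘ Z) k ⟩
        card Z + 1                                ∎)
        where
        open ≡-Reasoning
        swap-b-for-k : ∀ x c dk db → (dk ≡ true → x ≡ true × c ≡ false × db ≡ false)
          → (db ≡ true → x ≡ true × c ≡ true)
          → χ (x ∧ ((c ∧ not db) ∨ dk)) + χ db ≡ χ (x ∧ c) + χ dk
        swap-b-for-k x c true db at-k _ with at-k refl
        ... | refl , refl , refl = refl
        swap-b-for-k x c false true _ at-b with at-b refl
        ... | refl , refl = refl
        swap-b-for-k x c false false _ _ rewrite ∧-identityʳ c | ∨-identityʳ c = refl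
        at-k : ∀ a → does (a ≟ k) ≡ true → X a ≡ true × choice a ≡ false × does (a ≟ b) ≡ false
        at-k a ak with does-≟⇒≡ a k ak
        ... | refl = Xk , choice-k , dec-false (k ≟ b) k≢b
        at-b : ∀ a → does (a ≟ b) ≡ true → X a ≡ true × choice a ≡ true
        at-b a ab with does-≟⇒≡ a b ab
        ... | refl = Xb , choice-b

      n≤size : image S w ≡ false → n ≤ size S
      n≤size w∉ = pairFree⇒size≥n S S-pairFree
        (≤-trans ⌈n/2⌉≤card-Z (≤-trans (≤-reflexive (sym card-XQ)) (size-preimage-≥ Q)))
        where
        Q⇒choice : ∀ a → does (a ≟ k) ≡ false → Q a ≡ true → choice a ≡ true
        Q⇒choice a ak Qa = proj₁ (∧-true (trans (sym (∨-identityʳ (choice∖b a))) (trans (cong (choice∖b a ∨_) (sym ak)) Qa)))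
        S-pairFree : PairFree S
        S-pairFree a a∈ with does (a ≟ k) in ak | does (partner a ≟ k) in a′k
        ... | true | _ = trans (cong (image S ∘ partner) (does-≟⇒≡ a k ak)) (trans (cong (image S) (partner-involutive w)) w∉)
        ... | false | true = ⊥-elim (true≢false (trans (sym a∈) (trans (cong (image S) a≡w) w∉)))
          where
          a≡w : a ≡ w
          a≡w = trans (sym (partner-involutive a)) (trans (cong partner (does-≟⇒≡ (partner a) k a′k)) (partner-involutive w))
        ... | false | false = preimage-pair-free-at Q a (Q⇒choice a ak) (Q⇒choice (partner a) a′k)
          (outside-X-pair-free S) a∈

      size<n : image S w ≡ false → size S < n
      size<n w∉ = subst (_≤ n) (+-comm (size S) 1) (begin
        size S + 1                                     ≤⟨ +-monoˡ-≤ 1 (size-preimage-≤ Q W∖w outside⊆W∖w) ⟩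
        card (λ a → X a ∧ Q a) + card W∖w + 1          ≡⟨ +-assoc (card (λ a → X a ∧ Q a)) (card W∖w) 1 ⟩
        card (λ a → X a ∧ Q a) + (card W∖w + 1)        ≡⟨ cong₂ _+_ card-XQ (card-remove W w Ww) ⟩
        card Z + card W                                ≡⟨ card-Z+card-W≡n ⟩
        n                                              ∎)
        where
        open ≤-Reasoning
        W∖w : Fin (2 * n) → Bool
        W∖w a = W a ∧ not (does (a ≟ w))
        outside⊆W∖w : ∀ a → X a ≡ false → image S a ≡ true → W∖w a ≡ true
        outside⊆W∖w a ¬Xa a∈ = cong₂ _∧_ (image-¬X⇒W S a ¬Xa a∈)
          (cong not (dec-false (a ≟ w) λ a≡w → true≢false (trans (sym a∈) (trans (cong (image S) a≡w) w∉))))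

      w∈image∖b : image (preimage ≢b) w ≡ true
      w∈image∖b = image-preimage-mono Q ≢b Q⊆≢b w (¬-not λ w∉ → <⇒≱ (size<n w∉) (n≤size w∉))

    absurd : ⊥
    absurd = <⇒≱ (subst (_≤ card X + card W) (+-suc n 1) (+-mono-≤ n≤card-X 2≤card-W)) (begin
      card X + card W                                  ≡⟨ ∑-distrib-+ (χ ∘ X) (χ ∘ W) ⟨
      sum (λ a → χ (X a) + χ (W a))                    ≤⟨ sum-mono-≤ _ _ X∪W⊆image∖b+b ⟩
      sum (λ a → χ (image (preimage ≢b) a) + δ b a)    ≡⟨ sum-+-δ (χ ∘ image (preimage ≢b)) b ⟩
      size (preimage ≢b) + 1                           ≤⟨ +-monoˡ-≤ 1 (size-preimage-≢≤n b Xb ¬Xb′ ¬Wb′) ⟩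
      n + 1                                            ∎)
      where
      open ≤-Reasoning
      covered : ∀ x w i d → (x ≡ true → i ≡ not d) → (x ≡ true → w ≡ false) → (x ≡ false → w ≡ true → i ≡ true)
        → χ x + χ w ≤ χ i + χ d
      covered true _ _ true i≡ w≡ _ rewrite i≡ refl | w≡ refl = s≤s z≤n
      covered true _ _ false i≡ w≡ _ rewrite i≡ refl | w≡ refl = s≤s z≤n
      covered false false _ _ _ _ _ = z≤n
      covered false true _ _ _ _ i≡ rewrite i≡ refl refl = s≤s z≤n
      X∪W⊆image∖b+b : ∀ a → χ (X a) + χ (W a) ≤ χ (image (preimage ≢b) a) + δ b a
      X∪W⊆image∖b+b a = covered (X a) (W a) (image (preimage ≢b) a) (does (a ≟ b))
        (image-preimage-X ≢b a) (X⇒¬W a) (λ _ Wa → Covering.w∈image∖b a Wa)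

theorem2 : (n : ℕ) → 4 ≤ n → (R : Subset (2 * n) → Set) → Restrictive n R
    → ¬ (Σ (PosetEmbedding n) λ f → (S : Subset n) → R (PosetEmbedding.fun f S))
theorem2 n 4≤n R restrictive (e , f∈R) = Embedded.Pivot.absurd n R restrictive e f∈R 4≤n
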